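{- If $G$ is a connected claw-free graph of order $n$ with minimum degree $\delta(G) \ge 2$, then $\Psi_g^+(G) \ge \frac{1}{2}n$ and $\Psi_g^-(G) \ge \frac{1}{2}n$.
   Context: All graphs are finite and simple. A graph is claw-free if it has no induced subgraph isomorphic to $K_{1,3}$. For a set $S$ of vertices of a graph $G$, a vertex $v \in S$ is an enclave of $S$ if $N[v] \subseteq S$; $S$ is enclaveless if it contains no enclave. The competition-enclaveless game on $G$ is played by Maximizer and Minimizer, who alternately choose a vertex $v$ not in the set $S$ of previously chosen vertices such that $S \cup \{v\}$ is enclaveless; the game ends when no such vertex exists. Maximizer aims to maximize and Minimizer to minimize the final $|S|$. $\Psi_g^+(G)$ is the final $|S|$ when Maximizer moves first and both play optimally; $\Psi_g^-(G)$ is the same when Minimizer moves first. -}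

module Defs where

open import Data.Bool using (Bool; true; false; _∨_; if_then_else_)
open import Data.Nat using (ℕ; zero; suc; _≤_; _⊔_; _⊓_)
open import Data.Fin using (Fin; _≟_)
open import Data.Fin.Subset using (Subset; _∈_; _∉_; _⊆_; ⁅_⁆; _∪_; ∣_∣) renaming (⊥ to ∅)
open import Data.Fin.Subset.Properties using (_∈?_; _⊆?_)
open import Data.Fin.Properties using (any?; all?)
open import Data.List using (List; []; _∷_; map; filter; foldr; allFin)
open import Data.Vec using (tabulate)
open import Data.Product using (Σ; ∃; _×_; _,_)
open import Relation.Nullary using (¬_; Dec; yes; no)
open import Relation.Nullary.Decidable using (⌊_⌋; ¬?; _×-dec_)
open import Relation.Binary.PropositionalEquality using (_≡_; _≢_)

record Graph (n : ℕ) : Set where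
  field
    adj    : Fin n → Fin n → Bool
    sym    : ∀ u v → adj u v ≡ adj v u
    irrefl : ∀ v → adj v v ≡ false
open Graph public

module _ {n : ℕ} (G : Graph n) where

  Adj : Fin n → Fin n → Set
  Adj u v = adj G u v ≡ true

  N : Fin n → Subset n
  N v = tabulate (λ u → adj G v u)

  N[_] : Fin n → Subset n
  N[ v ] = N v ∪ ⁅ v ⁆

  degree : Fin n → ℕ
  degree v = ∣ N v ∣

  minDegree≥ : ℕ → Set
  minDegree≥ k = ∀ v → k ≤ degree v

  data Reachable : Fin n → Fin n → Set where
    here  : ∀ {u} → Reachable u u
    there : ∀ {u v w} → Adj u v → Reachable v w → Reachable u w

  Connected : Set
  Connected = ∀ u v → Reachable u v

  Claw : Fin n → Fin n → Fin n → Fin n → Set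
  Claw c a b d =
    Adj c a × Adj c b × Adj c d ×
    a ≢ b × a ≢ d × b ≢ d ×
    ¬ Adj a b × ¬ Adj a d × ¬ Adj b d

  ClawFree : Set
  ClawFree = ∀ c a b d → ¬ Claw c a b d

  Enclave : Subset n → Fin n → Set
  Enclave S v = v ∈ S × N[ v ] ⊆ S

  Enclaveless : Subset n → Set
  Enclaveless S = ∀ v → ¬ Enclave S v

  enclaveless? : (S : Subset n) → Dec (Enclaveless S)
  enclaveless? S = all? (λ v → ¬? ((v ∈? S) ×-dec (N[ v ] ⊆? S)))

  LegalMove : Subset n → Fin n → Set
  LegalMove S v = v ∉ S × Enclaveless (S ∪ ⁅ v ⁆)

  legalMove? : (S : Subset n) (v : Fin n) → Dec (LegalMove S v)
  legalMove? S v = ¬? (v ∈? S) ×-dec enclaveless? (S ∪ ⁅ v ⁆)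

  legalMoves : Subset n → List (Fin n)
  legalMoves S = filter (legalMove? S) (allFin n)

  data Player : Set where
    Maximizer Minimizer : Player

  other : Player → Player
  other Maximizer = Minimizer
  other Minimizer = Maximizer

  -- The fuel
  -- argument bounds the number of remaining moves; since each move adds a new
  -- vertex, fuel n from the empty set never runs out before the game ends.
  gameValue : ℕ → Player → Subset n → ℕ
  gameValue zero     p         S = ∣ S ∣
  gameValue (suc k)  p         S with legalMoves S
  ... | []     = ∣ S ∣
  ... | v ∷ vs = pick p (gameValue k (other p) (S ∪ ⁅ v ⁆))
                        (map (λ w → gameValue k (other p) (S ∪ ⁅ w ⁆)) vs)
    where
      pick : Player → ℕ → List ℕ → ℕ
      pick Maximizer x xs = foldr _⊔_ x xs
      pick Minimizer x xs = foldr _⊓_ x xs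

  Ψg⁺ : ℕ
  Ψg⁺ = gameValue n Maximizer ∅

  Ψg⁻ : ℕ
  Ψg⁻ = gameValue n Minimizer ∅

-- When the game ends, the chosen set S is a maximal enclaveless set, so it
-- suffices that every such S has 2∣S∣ ≥ n.  Let every vertex d outside S send two units of charge into S.  If all neighbours of
-- d lie in S ("surrounded"), d sends one unit to each of its at least two neighbours.
-- Otherwise, by maximality, S ∪ {d} has an enclave u; it lies in S, is adjacent to d, and d
-- is its only neighbour outside S, so d sends two units to u.  A vertex of S receiving two
-- units this way receives nothing else; otherwise it only receives single units from
-- surrounded neighbours, which are pairwise non-adjacent, so claw-freeness allows at most
-- two of them.  Hence 2∣V ∖ S∣ ≤ 2∣S∣.

module Submission where

open import Data.Bool using (true; false; if_then_else_)
open import Data.Nat using (ℕ; zero; suc; _+_; _*_; _≤_; z≤n; s≤s)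
open import Data.Nat.Properties
  using ( ≤-refl; ≤-reflexive; ≤-trans; ≤-antisym; ≮⇒≥; module ≤-Reasoning
        ; +-identityʳ; +-suc; +-mono-≤; +-monoˡ-≤; +-monoʳ-≤; m≤m+n; m≤n+m
        ; *-identityʳ; *-zeroʳ; *-monoʳ-≤; *-cancelˡ-≤; ⊔-sel; ⊓-sel; +-*-semiring )
open import Data.Fin using (Fin; zero; suc; punchIn)
open import Data.Fin.Properties using (suc-injective; punchInᵢ≢i; any?)
open import Data.Fin.Subset using (Subset; _∈_; _∉_; _⊆_; _∪_; ⁅_⁆; ∣_∣) renaming (⊥ to ∅)
open import Data.Fin.Subset.Properties
  using ( _∈?_; _⊆?_; x∈p∪q⁻; p⊆p∪q; q⊆p∪q; x∈⁅x⁆; x∈⁅y⁆⇒x≡y; ∈⊤; ∉⊥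
        ; ∣p∣≤n; ∣p∣≡n⇒p≡⊤; p⊂q⇒∣p∣<∣q∣ )
open import Data.Vec using ([]; _∷_)
open import Data.Vec.Properties using (lookup∘tabulate; []=⇒lookup; lookup⇒[]=)
open import Data.List as List using ([]; _∷_; allFin)
open import Data.List.Properties using (foldr-preservesᵇ)
open import Data.List.Relation.Unary.All as All using (All; []; _∷_)
open import Data.List.Relation.Unary.All.Properties using (all-filter; map⁺)
open import Data.List.Membership.Propositional using () renaming (_∈_ to _∈ₗ_)
open import Data.List.Membership.Propositional.Properties using (∈-filter⁺; ∈-allFin)
open import Data.Product using (Σ; ∃; _×_; _,_)
open import Data.Sum using (inj₁; inj₂)
open import Data.Empty using (⊥-elim)
open import Algebra.Definitions using (Selective)
open import Algebra.Properties.Semiring.Sum +-*-semiring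
  using ( sum; sum-syntax; sum-remove; sum-cong-≗; sum-replicate-zero
        ; ∑-comm; ∑-distrib-+; *-distribˡ-sum )
open import Function using (_∘_; case_of_; Injective)
open import Relation.Nullary using (¬_; Dec; yes; no; does; contradiction)
open import Relation.Nullary.Decidable using (¬?; _×-dec_)
open import Relation.Binary.PropositionalEquality
  using (_≡_; _≢_; refl; sym; trans; cong; cong₂; subst; module ≡-Reasoning)

open import Defs hiding (sym)

𝟙 : {P : Set} → Dec P → ℕ
𝟙 p = if does p then 1 else 0

𝟙-mono : {P Q : Set} (p : Dec P) (q : Dec Q) → (P → Q) → 𝟙 p ≤ 𝟙 q
𝟙-mono (yes p) (yes _) _   = ≤-refl
𝟙-mono (yes p) (no ¬q) p→q = contradiction (p→q p) ¬q
𝟙-mono (no _)  _       _   = z≤n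

𝟙≤1 : {P : Set} (p : Dec P) → 𝟙 p ≤ 1
𝟙≤1 (yes _) = ≤-refl
𝟙≤1 (no _)  = z≤n

𝟙-yes : {P : Set} (p : Dec P) → P → 𝟙 p ≡ 1
𝟙-yes (yes _) _ = refl
𝟙-yes (no ¬p) p = contradiction p ¬p

𝟙-no : {P : Set} (p : Dec P) → ¬ P → 𝟙 p ≡ 0
𝟙-no (yes p) ¬p = contradiction p ¬p
𝟙-no (no _)  _  = refl

𝟙-witness : {P : Set} (p : Dec P) → 1 ≤ 𝟙 p → P
𝟙-witness (yes p) _ = p

*𝟙-≤ : ∀ {P : Set} {x} k (p : Dec P) → (P → k ≤ x) → k * 𝟙 p ≤ x
*𝟙-≤ k (yes p) k≤x = ≤-trans (≤-reflexive (*-identityʳ k)) (k≤x p)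
*𝟙-≤ k (no _)  _   = ≤-trans (≤-reflexive (*-zeroʳ k)) z≤n

≤-*𝟙 : ∀ {P : Set} {x} k (p : Dec P) → (P → x ≤ k) → (¬ P → x ≡ 0) → x ≤ k * 𝟙 p
≤-*𝟙 k (yes p) x≤k _   = ≤-trans (x≤k p) (≤-reflexive (sym (*-identityʳ k)))
≤-*𝟙 k (no ¬p) _   x≡0 = ≤-trans (≤-reflexive (x≡0 ¬p)) z≤n

𝟙-complement : {P : Set} (p : Dec P) → 𝟙 p + 𝟙 (¬? p) ≡ 1
𝟙-complement (yes _) = refl
𝟙-complement (no _)  = refl

∑-mono-≤ : ∀ {n} {f g : Fin n → ℕ} → (∀ i → f i ≤ g i) → ∑[ i < n ] f i ≤ ∑[ i < n ] g i
∑-mono-≤ {zero}  f≤g = z≤n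
∑-mono-≤ {suc n} f≤g = +-mono-≤ (f≤g zero) (∑-mono-≤ (f≤g ∘ suc))

∑-ones : ∀ n → ∑[ i < n ] 1 ≡ n
∑-ones zero    = refl
∑-ones (suc n) = cong suc (∑-ones n)

∑-zero : ∀ {n} {f : Fin n → ℕ} → (∀ i → f i ≡ 0) → ∑[ i < n ] f i ≡ 0
∑-zero {n} f≡0 = trans (sum-cong-≗ f≡0) (sum-replicate-zero n)

term≤∑ : ∀ {n} (f : Fin n → ℕ) i → f i ≤ ∑[ j < n ] f j
term≤∑ {suc n} f i = ≤-trans (m≤m+n (f i) _) (≤-reflexive (sym (sum-remove f)))

∑-concentrated : ∀ {n} (f : Fin n → ℕ) i → (∀ j → j ≢ i → f j ≡ 0) → ∑[ j < n ] f j ≡ f i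
∑-concentrated {suc n} f i f≡0 = begin
  sum f                             ≡⟨ sum-remove f ⟩
  f i + ∑[ j < n ] f (punchIn i j)  ≡⟨ cong (f i +_) (∑-zero λ j → f≡0 _ (punchInᵢ≢i i j)) ⟩
  f i + 0                           ≡⟨ +-identityʳ (f i) ⟩
  f i                               ∎
  where open ≡-Reasoning

∣p∣≡∑𝟙 : ∀ {n} (p : Subset n) → ∣ p ∣ ≡ ∑[ i < n ] 𝟙 (i ∈? p)
∣p∣≡∑𝟙 []          = refl
∣p∣≡∑𝟙 (true ∷ p)  = cong suc (∣p∣≡∑𝟙 p)
∣p∣≡∑𝟙 (false ∷ p) = ∣p∣≡∑𝟙 p

∑≥k⇒k-support : ∀ {n} k (f : Fin n → ℕ) → (∀ i → f i ≤ 1) → k ≤ ∑[ i < n ] f i →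
            Σ (Fin k → Fin n) λ g → Injective _≡_ _≡_ g × (∀ a → 1 ≤ f (g a))
∑≥k⇒k-support zero    f _ _ = (λ ()) , (λ {}) , λ ()
∑≥k⇒k-support {zero}  (suc k) f _ ()
∑≥k⇒k-support {suc n} (suc k) f f≤1 k≤∑ = split (f zero) refl (f≤1 zero) k≤∑
  where
  split : ∀ x → x ≡ f zero → x ≤ 1 → suc k ≤ x + ∑[ i < n ] f (suc i) →
          Σ (Fin (suc k) → Fin (suc n)) λ g → Injective _≡_ _≡_ g × (∀ a → 1 ≤ f (g a))
  split zero    _ _ k≤∑ with ∑≥k⇒k-support (suc k) (f ∘ suc) (f≤1 ∘ suc) k≤∑
  ... | g , g-inj , fg≥1 = suc ∘ g , g-inj ∘ suc-injective , fg≥1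
  split (suc zero) f0≡1 _ (s≤s k≤∑) with ∑≥k⇒k-support k (f ∘ suc) (f≤1 ∘ suc) k≤∑
  ... | g , g-inj , fg≥1 = g′ , g′-inj , g′≥1
    where
    g′ : Fin (suc k) → Fin (suc n)
    g′ zero    = zero
    g′ (suc a) = suc (g a)
    g′-inj : Injective _≡_ _≡_ g′
    g′-inj {zero}  {zero}  _  = refl
    g′-inj {suc a} {suc b} eq = cong suc (g-inj (suc-injective eq))
    g′≥1 : ∀ a → 1 ≤ f (g′ a)
    g′≥1 zero    = ≤-reflexive f0≡1
    g′≥1 (suc a) = fg≥1 a
  split (suc (suc _)) _ (s≤s ()) _

∑𝟙+∑𝟙¬ : ∀ {n} {P : Fin n → Set} (P? : ∀ i → Dec (P i)) →
          ∑[ i < n ] 𝟙 (P? i) + ∑[ i < n ] 𝟙 (¬? (P? i)) ≡ n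
∑𝟙+∑𝟙¬ {n} P? = begin
  ∑[ i < n ] 𝟙 (P? i) + ∑[ i < n ] 𝟙 (¬? (P? i))  ≡⟨ ∑-distrib-+ (𝟙 ∘ P?) (𝟙 ∘ ¬? ∘ P?) ⟨
  ∑[ i < n ] (𝟙 (P? i) + 𝟙 (¬? (P? i)))           ≡⟨ sum-cong-≗ (𝟙-complement ∘ P?) ⟩
  ∑[ i < n ] 1                                    ≡⟨ ∑-ones n ⟩
  n                                               ∎
  where open ≡-Reasoning

⊆-∪⁅⁆ : ∀ {n} {p q : Subset n} {x} → p ⊆ q ∪ ⁅ x ⁆ → x ∉ p → p ⊆ q
⊆-∪⁅⁆ {q = q} {x} p⊆q∪x x∉p {y} y∈p with x∈p∪q⁻ q ⁅ x ⁆ (p⊆q∪x y∈p)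
... | inj₁ y∈q = y∈q
... | inj₂ y∈x rewrite x∈⁅y⁆⇒x≡y x y∈x = ⊥-elim (x∉p y∈p)

module _ {n : ℕ} (G : Graph n) where

  Adj⇒∈N : ∀ {v w} → Adj G v w → w ∈ N G v
  Adj⇒∈N {v} {w} a = lookup⇒[]= w _ (trans (lookup∘tabulate (adj G v) w) a)

  ∈N⇒Adj : ∀ {v w} → w ∈ N G v → Adj G v w
  ∈N⇒Adj {v} {w} w∈N = trans (sym (lookup∘tabulate (adj G v) w)) ([]=⇒lookup w∈N)

  ∈N-sym : ∀ {v w} → w ∈ N G v → v ∈ N G w
  ∈N-sym {v} {w} w∈N = Adj⇒∈N (trans (Graph.sym G w v) (∈N⇒Adj w∈N))

  ∉N-self : ∀ v → v ∉ N G v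
  ∉N-self v v∈N with trans (sym (∈N⇒Adj v∈N)) (irrefl G v)
  ... | ()

  N⊆N[] : ∀ v → N G v ⊆ N[_] G v
  N⊆N[] v = p⊆p∪q ⁅ v ⁆

  ∃-enclave : ∀ T → ¬ Enclaveless G T → ∃ (Enclave G T)
  ∃-enclave T ¬el with any? (λ v → (v ∈? T) ×-dec (N[_] G v ⊆? T))
  ... | yes e  = e
  ... | no ¬e = ⊥-elim (¬el λ v e → ¬e (v , e))

module MaximalEnclaveless {n : ℕ} (G : Graph n) (S : Subset n)
                          (enclaveless : Enclaveless G S) (maximal : ∀ v → ¬ LegalMove G S v) where

  Surrounded Exposed : Fin n → Set
  Surrounded d = d ∉ S × N G d ⊆ S
  Exposed    d = d ∉ S × ¬ N G d ⊆ S

  Private : Fin n → Fin n → Set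
  Private u d = u ∈ S × d ∈ N G u × N G u ⊆ S ∪ ⁅ d ⁆

  surrounded? : ∀ d → Dec (Surrounded d)
  surrounded? d = ¬? (d ∈? S) ×-dec (N G d ⊆? S)

  exposed? : ∀ d → Dec (Exposed d)
  exposed? d = ¬? (d ∈? S) ×-dec ¬? (N G d ⊆? S)

  private? : ∀ u d → Dec (Private u d)
  private? u d = (u ∈? S) ×-dec (d ∈? N G u) ×-dec (N G u ⊆? S ∪ ⁅ d ⁆)

  EdgeCharge PrivateCharge : Fin n → Fin n → Set
  EdgeCharge    d u = Surrounded d × u ∈ N G d
  PrivateCharge d u = Exposed d × Private u d

  edgeCharge? : ∀ d u → Dec (EdgeCharge d u)
  edgeCharge? d u = surrounded? d ×-dec u ∈? N G d

  privateCharge? : ∀ d u → Dec (PrivateCharge d u)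
  privateCharge? d u = exposed? d ×-dec private? u d

  private-unique : ∀ {u d d′} → Private u d → d′ ∉ S → d′ ∈ N G u → d′ ≡ d
  private-unique {d = d} (_ , _ , Nu⊆S∪d) d′∉S d′∈Nu with x∈p∪q⁻ S ⁅ d ⁆ (Nu⊆S∪d d′∈Nu)
  ... | inj₁ d′∈S = ⊥-elim (d′∉S d′∈S)
  ... | inj₂ d′∈d = x∈⁅y⁆⇒x≡y d d′∈d

  -- Adding an exposed d creates an enclave v; v ≠ d since d has a neighbour outside S,
  -- and v must see d since S itself has no enclave.
  exposed⇒private : ∀ {d} → Exposed d → ∃ λ u → Private u d
  exposed⇒private {d} (d∉S , Nd⊈S)
    with ∃-enclave G (S ∪ ⁅ d ⁆) (λ el → maximal d (d∉S , el))
  ... | v , v∈S∪d , N[v]⊆S∪d with x∈p∪q⁻ S ⁅ d ⁆ v∈S∪d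
  ...   | inj₂ v∈d rewrite x∈⁅y⁆⇒x≡y d v∈d =
          ⊥-elim (Nd⊈S (⊆-∪⁅⁆ (λ w∈N → N[v]⊆S∪d (N⊆N[] G d w∈N)) (∉N-self G d)))
  ...   | inj₁ v∈S with d ∈? N G v
  ...     | yes d∈Nv = v , v∈S , d∈Nv , λ w∈N → N[v]⊆S∪d (N⊆N[] G v w∈N)
  ...     | no  d∉Nv = ⊥-elim (enclaveless v (v∈S , ⊆-∪⁅⁆ N[v]⊆S∪d d∉N[v]))
    where
    d∉N[v] : d ∉ N[_] G v
    d∉N[v] d∈N[v] with x∈p∪q⁻ (N G v) ⁅ v ⁆ d∈N[v]
    ... | inj₁ d∈Nv = d∉Nv d∈Nv
    ... | inj₂ d∈v rewrite x∈⁅y⁆⇒x≡y v d∈v = d∉S v∈S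

  surrounded-independent : ∀ {a b} → Surrounded a → Surrounded b → ¬ Adj G a b
  surrounded-independent (_ , Na⊆S) (b∉S , _) a~b = b∉S (Na⊆S (Adj⇒∈N G a~b))

  surroundedNeighbours≤2 : ClawFree G → ∀ u → ∑[ d < n ] 𝟙 (edgeCharge? d u) ≤ 2
  surroundedNeighbours≤2 claw-free u = ≮⇒≥ λ 3≤∑ →
    let g , g-inj , g-leaf = ∑≥k⇒k-support 3 (λ d → 𝟙 (edgeCharge? d u))
                                             (λ d → 𝟙≤1 (edgeCharge? d u)) 3≤∑
        (sa , u~a) = leaf (g zero) (g-leaf zero)
        (sb , u~b) = leaf (g (suc zero)) (g-leaf (suc zero))
        (sc , u~c) = leaf (g (suc (suc zero))) (g-leaf (suc (suc zero)))
    in claw-free u _ _ _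
         ( u~a , u~b , u~c
         , (λ eq → contradiction (g-inj eq) λ ())
         , (λ eq → contradiction (g-inj eq) λ ())
         , (λ eq → contradiction (g-inj eq) λ ())
         , surrounded-independent sa sb
         , surrounded-independent sa sc
         , surrounded-independent sb sc )
    where
    leaf : ∀ a → 1 ≤ 𝟙 (edgeCharge? a u) → Surrounded a × Adj G u a
    leaf a 1≤𝟙 = let (sa , u∈Na) = 𝟙-witness (edgeCharge? a u) 1≤𝟙
                 in sa , ∈N⇒Adj G (∈N-sym G u∈Na)

  charge : Fin n → Fin n → ℕ
  charge d u = 𝟙 (edgeCharge? d u) + 2 * 𝟙 (privateCharge? d u)

  charge-sent : minDegree≥ G 2 → ∀ d → 2 * 𝟙 (¬? (d ∈? S)) ≤ ∑[ u < n ] charge d u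
  charge-sent δ≥2 d = *𝟙-≤ 2 (¬? (d ∈? S)) λ d∉S → sent d∉S (N G d ⊆? S)
    where
    open ≤-Reasoning
    sent : d ∉ S → Dec (N G d ⊆ S) → 2 ≤ ∑[ u < n ] charge d u
    sent d∉S (yes Nd⊆S) = begin
      2                               ≤⟨ δ≥2 d ⟩
      degree G d                      ≡⟨ ∣p∣≡∑𝟙 (N G d) ⟩
      ∑[ u < n ] 𝟙 (u ∈? N G d)       ≤⟨ ∑-mono-≤ (λ u → 𝟙-mono (u ∈? N G d) (edgeCharge? d u) ((d∉S , Nd⊆S) ,_)) ⟩
      ∑[ u < n ] 𝟙 (edgeCharge? d u)  ≤⟨ ∑-mono-≤ (λ u → m≤m+n (𝟙 (edgeCharge? d u)) _) ⟩
      ∑[ u < n ] charge d u           ∎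
    sent d∉S (no Nd⊈S) with exposed⇒private (d∉S , Nd⊈S)
    ... | u , u-private = begin
      2                           ≡⟨ cong (2 *_) (𝟙-yes (privateCharge? d u) ((d∉S , Nd⊈S) , u-private)) ⟨
      2 * 𝟙 (privateCharge? d u)  ≤⟨ m≤n+m _ (𝟙 (edgeCharge? d u)) ⟩
      charge d u                  ≤⟨ term≤∑ (charge d) u ⟩
      ∑[ u < n ] charge d u       ∎

  charge-outside : ∀ {u} → u ∉ S → ∀ d → charge d u ≡ 0
  charge-outside {u} u∉S d = cong₂ (λ x y → x + 2 * y)
    (𝟙-no (edgeCharge? d u) λ ((_ , Nd⊆S) , u∈Nd) → u∉S (Nd⊆S u∈Nd))
    (𝟙-no (privateCharge? d u) λ (_ , u∈S , _) → u∉S u∈S)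

  charge-received≤2 : ClawFree G → ∀ u → ∑[ d < n ] charge d u ≤ 2
  charge-received≤2 claw-free u with any? (λ d → privateCharge? d u)
  ... | yes (d₀ , (_ , Nd₀⊈S) , u-private) = begin
      ∑[ d < n ] charge d u        ≡⟨ ∑-concentrated (λ d → charge d u) d₀ charge-elsewhere ⟩
      charge d₀ u                  ≡⟨ cong (_+ 2 * 𝟙 (privateCharge? d₀ u)) no-edgeCharge ⟩
      2 * 𝟙 (privateCharge? d₀ u)  ≤⟨ *-monoʳ-≤ 2 (𝟙≤1 (privateCharge? d₀ u)) ⟩
      2                            ∎
    where
    open ≤-Reasoning
    no-edgeCharge : 𝟙 (edgeCharge? d₀ u) ≡ 0
    no-edgeCharge = 𝟙-no (edgeCharge? d₀ u) λ ((_ , Nd₀⊆S) , _) → Nd₀⊈S Nd₀⊆S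
    charge-elsewhere : ∀ d → d ≢ d₀ → charge d u ≡ 0
    charge-elsewhere d d≢d₀ = cong₂ (λ x y → x + 2 * y)
      (𝟙-no (edgeCharge? d u) λ ((d∉S , _) , u∈Nd) →
        d≢d₀ (private-unique u-private d∉S (∈N-sym G u∈Nd)))
      (𝟙-no (privateCharge? d u) λ ((d∉S , _) , (_ , d∈Nu , _)) →
        d≢d₀ (private-unique u-private d∉S d∈Nu))
  ... | no no-private = begin
      ∑[ d < n ] charge d u           ≡⟨ sum-cong-≗ charge≡edgeCharge ⟩
      ∑[ d < n ] 𝟙 (edgeCharge? d u)  ≤⟨ surroundedNeighbours≤2 claw-free u ⟩
      2                               ∎
    where
    open ≤-Reasoning
    charge≡edgeCharge : ∀ d → charge d u ≡ 𝟙 (edgeCharge? d u)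
    charge≡edgeCharge d = begin-equality
      charge d u                                 ≡⟨ cong (λ y → 𝟙 (edgeCharge? d u) + 2 * y)
                                                      (𝟙-no (privateCharge? d u) λ e → no-private (d , e)) ⟩
      𝟙 (edgeCharge? d u) + 0                    ≡⟨ +-identityʳ _ ⟩
      𝟙 (edgeCharge? d u)                        ∎

  charge-received : ClawFree G → ∀ u → ∑[ d < n ] charge d u ≤ 2 * 𝟙 (u ∈? S)
  charge-received claw-free u = ≤-*𝟙 2 (u ∈? S)
    (λ _ → charge-received≤2 claw-free u)
    (λ u∉S → ∑-zero (charge-outside u∉S))

  n≤2∣S∣ : ClawFree G → minDegree≥ G 2 → n ≤ 2 * ∣ S ∣
  n≤2∣S∣ claw-free δ≥2 = begin
    n                   ≡⟨ ∑𝟙+∑𝟙¬ (_∈? S) ⟨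
    inside + outside    ≤⟨ +-monoʳ-≤ inside outside≤inside ⟩
    inside + inside     ≡⟨ cong (inside +_) (+-identityʳ inside) ⟨
    2 * inside          ≡⟨ cong (2 *_) (∣p∣≡∑𝟙 S) ⟨
    2 * ∣ S ∣           ∎
    where
    open ≤-Reasoning
    inside outside : ℕ
    inside  = ∑[ u < n ] 𝟙 (u ∈? S)
    outside = ∑[ d < n ] 𝟙 (¬? (d ∈? S))
    outside≤inside : outside ≤ inside
    outside≤inside = *-cancelˡ-≤ 2 (begin
      2 * outside                           ≡⟨ *-distribˡ-sum 2 (λ d → 𝟙 (¬? (d ∈? S))) ⟩
      ∑[ d < n ] (2 * 𝟙 (¬? (d ∈? S)))      ≤⟨ ∑-mono-≤ (charge-sent δ≥2) ⟩
      ∑[ d < n ] ∑[ u < n ] charge d u      ≡⟨ ∑-comm charge ⟩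
      ∑[ u < n ] ∑[ d < n ] charge d u      ≤⟨ ∑-mono-≤ (charge-received claw-free) ⟩
      ∑[ u < n ] (2 * 𝟙 (u ∈? S))           ≡⟨ *-distribˡ-sum 2 (λ u → 𝟙 (u ∈? S)) ⟨
      2 * inside                            ∎)

foldr-selective : ∀ {P : ℕ → Set} {op : ℕ → ℕ → ℕ} → Selective _≡_ op →
                  ∀ {x xs} → P x → All P xs → P (List.foldr op x xs)
foldr-selective {P} {op} sel = foldr-preservesᵇ preserves
  where
  preserves : ∀ {x y} → P x → P y → P (op x y)
  preserves {x} {y} px py with sel x y
  ... | inj₁ op≡x = subst P (sym op≡x) px
  ... | inj₂ op≡y = subst P (sym op≡y) py

module _ {n : ℕ} (G : Graph n) where

  legalMoves-sound : ∀ S → All (LegalMove G S) (legalMoves G S)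
  legalMoves-sound S = all-filter (legalMove? G S) (allFin n)

  legalMoves-complete : ∀ S {v} → LegalMove G S v → v ∈ₗ legalMoves G S
  legalMoves-complete S {v} = ∈-filter⁺ (legalMove? G S) (∈-allFin v)

  full⇒noLegalMove : ∀ {S} → n ≤ ∣ S ∣ → ∀ v → ¬ LegalMove G S v
  full⇒noLegalMove {S} n≤∣S∣ v (v∉S , _) =
    v∉S (subst (v ∈_) (sym (∣p∣≡n⇒p≡⊤ (≤-antisym (∣p∣≤n S) n≤∣S∣))) ∈⊤)

  ∣S∣<∣S∪⁅v⁆∣ : ∀ {S : Subset n} {v} → v ∉ S → suc ∣ S ∣ ≤ ∣ S ∪ ⁅ v ⁆ ∣
  ∣S∣<∣S∪⁅v⁆∣ {S} {v} v∉S = p⊂q⇒∣p∣<∣q∣ (p⊆p∪q ⁅ v ⁆ , v , q⊆p∪q S ⁅ v ⁆ (x∈⁅x⁆ v) , v∉S)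

  module _ (P : ℕ → Set)
           (P-final : ∀ S → Enclaveless G S → (∀ v → ¬ LegalMove G S v) → P ∣ S ∣) where

    -- The fuel bound n ≤ ∣ S ∣ + k guarantees that the game is over whenever the fuel runs out.
    gameValue-satisfies : ∀ k p S → Enclaveless G S → n ≤ ∣ S ∣ + k → P (gameValue G k p S)
    move-satisfies : ∀ k p S {w} → n ≤ ∣ S ∣ + suc k → LegalMove G S w →
                     P (gameValue G k p (S ∪ ⁅ w ⁆))

    gameValue-satisfies zero p S el n≤∣S∣+0 =
      P-final S el (full⇒noLegalMove (≤-trans n≤∣S∣+0 (≤-reflexive (+-identityʳ ∣ S ∣))))
    gameValue-satisfies (suc k) p S el n≤ with legalMoves G S in eq
    ... | [] = P-final S el λ v lm → case subst (v ∈ₗ_) eq (legalMoves-complete S lm) of λ ()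
    ... | v ∷ vs with subst (All (LegalMove G S)) eq (legalMoves-sound S) | p
    ...   | lv ∷ lvs | Maximizer = foldr-selective {P = P} ⊔-sel
            (move-satisfies k Minimizer S n≤ lv) (map⁺ (All.map (move-satisfies k Minimizer S n≤) lvs))
    ...   | lv ∷ lvs | Minimizer = foldr-selective {P = P} ⊓-sel
            (move-satisfies k Maximizer S n≤ lv) (map⁺ (All.map (move-satisfies k Maximizer S n≤) lvs))

    move-satisfies k p S {w} n≤ (w∉S , el) = gameValue-satisfies k p (S ∪ ⁅ w ⁆) el (begin
      n                      ≤⟨ n≤ ⟩
      ∣ S ∣ + suc k          ≡⟨ +-suc ∣ S ∣ k ⟩
      suc ∣ S ∣ + k          ≤⟨ +-monoˡ-≤ k (∣S∣<∣S∪⁅v⁆∣ w∉S) ⟩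
      ∣ S ∪ ⁅ w ⁆ ∣ + k      ∎)
      where open ≤-Reasoning

theorem5p6 : (n : ℕ) (G : Graph n) → Connected G → ClawFree G → minDegree≥ G 2 →
    (n ≤ 2 * Ψg⁺ G) × (n ≤ 2 * Ψg⁻ G)
theorem5p6 n G _ claw-free δ≥2 = value≥n/2 Maximizer , value≥n/2 Minimizer
  where
  value≥n/2 : ∀ p → n ≤ 2 * gameValue G n p ∅
  value≥n/2 p = gameValue-satisfies G (λ s → n ≤ 2 * s)
    (λ S el maximal → MaximalEnclaveless.n≤2∣S∣ G S el maximal claw-free δ≥2)
    n p ∅ (λ v (v∈∅ , _) → ∉⊥ v∈∅) (m≤n+m n ∣ ∅ {n} ∣)
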